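{- Let $G$ be a finite simple König–Egerváry graph with $n$ vertices that is $\alpha^{+}$-stable and has no isolated vertices. Then $\alpha(G)=n/2$.
   Context: $\alpha(G)$ is the maximum size of a stable set, $\mu(G)$ the maximum size of a matching; $G$ is König–Egerváry if $\alpha(G)+\mu(G)=|V(G)|$. $G$ is $\alpha^{+}$-stable if $\alpha(G+e)=\alpha(G)$ for every edge $e$ of the complement $\overline{G}$. -}

module Defs where

open import Data.Nat using (ℕ; _≤_; _+_)
open import Data.Fin using (Fin)
open import Data.Fin.Subset using (Subset; _∈_; ∣_∣)
open import Data.Product using (_×_; _,_; ∃; proj₁; proj₂)
open import Data.Sum using (_⊎_; inj₁; inj₂)
open import Data.List using (List; []; _∷_; length; concatMap)
open import Data.List.Relation.Unary.All using (All)
open import Data.List.Relation.Unary.Unique.Propositional using (Unique)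
open import Relation.Nullary using (¬_)
open import Relation.Binary.PropositionalEquality using (_≡_; refl; sym)

record Graph (n : ℕ) : Set₁ where
  field
    Adj     : Fin n → Fin n → Set
    Adj-sym : ∀ {u v} → Adj u v → Adj v u
    Adj-irr : ∀ {v} → ¬ Adj v v
open Graph public

IsStable : ∀ {n} → Graph n → Subset n → Set
IsStable G S = ∀ u v → u ∈ S → v ∈ S → ¬ Adj G u v

IsAlpha : ∀ {n} → Graph n → ℕ → Set
IsAlpha {n} G a =
  (∃ λ (S : Subset n) → IsStable G S × ∣ S ∣ ≡ a)
  × (∀ (S : Subset n) → IsStable G S → ∣ S ∣ ≤ a)

endpoints : ∀ {n} → List (Fin n × Fin n) → List (Fin n)
endpoints = concatMap (λ e → proj₁ e ∷ proj₂ e ∷ [])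

IsMatching : ∀ {n} → Graph n → List (Fin n × Fin n) → Set
IsMatching G M = All (λ e → Adj G (proj₁ e) (proj₂ e)) M × Unique (endpoints M)

IsMu : ∀ {n} → Graph n → ℕ → Set
IsMu {n} G m =
  (∃ λ (M : List (Fin n × Fin n)) → IsMatching G M × length M ≡ m)
  × (∀ M → IsMatching G M → length M ≤ m)

IsKE : ∀ {n} → Graph n → Set
IsKE {n} G = ∀ a m → IsAlpha G a → IsMu G m → a + m ≡ n

addEdge : ∀ {n} (G : Graph n) (u v : Fin n) → ¬ u ≡ v → Graph n
addEdge G u v u≢v = record
  { Adj     = λ x y → Adj G x y ⊎ ((x ≡ u × y ≡ v) ⊎ (x ≡ v × y ≡ u))
  ; Adj-sym = λ { (inj₁ p) → inj₁ (Adj-sym G p)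
                ; (inj₂ (inj₁ (p , q))) → inj₂ (inj₂ (q , p))
                ; (inj₂ (inj₂ (p , q))) → inj₂ (inj₁ (q , p)) }
  ; Adj-irr = λ { (inj₁ p) → Adj-irr G p
                ; (inj₂ (inj₁ (refl , q))) → u≢v q
                ; (inj₂ (inj₂ (refl , q))) → u≢v (sym q) } }

IsAlphaPlusStable : ∀ {n} → Graph n → Set
IsAlphaPlusStable G =
  ∀ a → IsAlpha G a →
  ∀ u v → (u≢v : ¬ u ≡ v) → ¬ Adj G u v → IsAlpha (addEdge G u v u≢v) a

NoIsolated : ∀ {n} → Graph n → Set
NoIsolated G = ∀ v → ∃ λ u → Adj G v u

-- Fix a maximum matching M, so that α + |M| = n.  For any stable set T of size
-- α, the endpoints of M outside T are pairwise distinct, at least one per edge,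
-- and lie among the n - α = |M| vertices outside T; so M matches V - T into T:
-- every vertex missed by M is in T, and no edge of M avoids T.
-- Since 2|M| ≤ n, |M| ≤ α.  If |M| < α, some vertex u is missed by M, so u lies
-- in every maximum stable set; a neighbour w of u then lies in none, hence is
-- matched, say to s, and s lies in every maximum stable set too.  So u and s are
-- non-adjacent, yet a maximum stable set of G + us (which exists by
-- α⁺-stability) contains both, although us is an edge there.
-- Hence |M| = α and 2α = n.
--
-- Adjacency is not decidable, so a maximum matching exists only under a double
-- negation, which the decidable conclusion then discharges.
module Submission where

open import Defs
open import Data.Nat using (ℕ; _*_)
open import Relation.Binary.PropositionalEquality using (_≡_)

open import Data.Nat using (zero; suc; _+_; _∸_; _≤_; _<_; z≤n; s≤s; _≟_)
open import Data.Nat.Properties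
  using (≤-refl; ≤-reflexive; ≤-trans; ≤-antisym; n≤1+n; <⇒≱; ≮⇒≥; ≤∧≢⇒<; m<1+n⇒m≤n;
         m≤m+n; +-suc; +-identityʳ; +-cancelʳ-≤; +-monoˡ-<; m+n∸m≡n)
open import Data.Fin using (Fin)
open import Data.Fin.Properties using (pigeonhole; ¬∀⟶∃¬) renaming (<⇒≢ to <⇒≢ᶠ)
open import Data.Fin.Subset using (Subset; _∈_; _∉_; ⊤; ∁; _-_; ∣_∣)
open import Data.Fin.Subset.Properties
  using (_∈?_; ∈⊤; ∣⊤∣≡n; x∉p⇒x∈∁p; ∣∁p∣≡n∸∣p∣; x∈p∧x≢y⇒x∈p-y; x∈p⇒∣p-x∣<∣p∣)
open import Data.List using (List; []; _∷_; length; lookup; filter)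
open import Data.List.Properties using (filter-accept)
open import Data.List.Relation.Unary.All as All using (All; []; _∷_)
open import Data.List.Relation.Unary.All.Properties using (all-filter; ¬Any⇒All¬)
open import Data.List.Relation.Unary.Any as Any using (Any; here; there; index)
open import Data.List.Relation.Unary.Any.Properties using (lookup-index)
open import Data.List.Relation.Unary.AllPairs using ([]; _∷_)
open import Data.List.Relation.Unary.Unique.Propositional using (Unique)
open import Data.List.Relation.Unary.Unique.Propositional.Properties using (filter⁺)
open import Data.List.Membership.Propositional using () renaming (_∈_ to _∈ₗ_; _∉_ to _∉ₗ_)
open import Data.List.Membership.Propositional.Properties using (∈-filter⁻)
import Data.List.Membership.DecPropositional as DecMembership
open import Data.Product using (_×_; _,_; ∃; proj₁; proj₂)
open import Data.Sum as Sum using (_⊎_; inj₁; inj₂)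
open import Relation.Nullary using (¬_; Dec; yes; no; ¬?; contradiction)
open import Relation.Nullary.Decidable using (decidable-stable; ¬¬-excluded-middle)
open import Relation.Nullary.Negation using (¬¬-map)
open import Relation.Unary using (Decidable)
open import Relation.Binary.PropositionalEquality
  using (refl; sym; trans; cong; subst; subst₂; _≢_; ≢-sym; module ≡-Reasoning)

private
  variable
    n : ℕ

Edge : ℕ → Set
Edge n = Fin n × Fin n

SomeEnd BothEnds : (Fin n → Set) → Edge n → Set
SomeEnd  Q e = Q (proj₁ e) ⊎ Q (proj₂ e)
BothEnds Q e = Q (proj₁ e) × Q (proj₂ e)

_∈ₗ?_ : (v : Fin n) (xs : List (Fin n)) → Dec (v ∈ₗ xs)
_∈ₗ?_ {n} = DecMembership._∈?_ (Data.Fin._≟_ {n})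

length≤∣p∣ : ∀ {xs : List (Fin n)} (p : Subset n) → Unique xs → All (_∈ p) xs →
             length xs ≤ ∣ p ∣
length≤∣p∣ p [] [] = z≤n
length≤∣p∣ p (x≢xs ∷ !xs) (x∈p ∷ xs⊆p) =
  ≤-trans (s≤s (length≤∣p∣ (p - _) !xs xs⊆p-x)) (x∈p⇒∣p-x∣<∣p∣ x∈p)
  where
  xs⊆p-x = All.zipWith (λ (y∈p , x≢y) → x∈p∧x≢y⇒x∈p-y y∈p (≢-sym x≢y)) (xs⊆p , x≢xs)

length<n⇒∃∉ : (xs : List (Fin n)) → length xs < n → ∃ λ v → v ∉ₗ xs
length<n⇒∃∉ {n} xs xs<n = ¬∀⟶∃¬ n (_∈ₗ xs) (_∈ₗ? xs) λ every∈ →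
  let i , j , i<j , same-index = pigeonhole xs<n (λ v → index (every∈ v))
      open ≡-Reasoning
  in <⇒≢ᶠ i<j (begin
       i                            ≡⟨ lookup-index (every∈ i) ⟩
       lookup xs (index (every∈ i)) ≡⟨ cong (lookup xs) same-index ⟩
       lookup xs (index (every∈ j)) ≡⟨ sym (lookup-index (every∈ j)) ⟩
       j                            ∎)

length-endpoints : (M : List (Edge n)) → length (endpoints M) ≡ length M + length M
length-endpoints []      = refl
length-endpoints (_ ∷ M) = cong suc (trans (cong suc (length-endpoints M)) (sym (+-suc _ _)))

matching-size-bound : (M : List (Edge n)) → Unique (endpoints M) → length M + length M ≤ n
matching-size-bound {n} M !ends =
  subst₂ _≤_ (length-endpoints M) (∣⊤∣≡n n) (length≤∣p∣ ⊤ !ends (All.tabulate (λ _ → ∈⊤)))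

module _ {n} {Q : Fin n → Set} (Q? : Decidable Q) where

  private
    ∣filter∣ : List (Fin n) → ℕ
    ∣filter∣ xs = length (filter Q? xs)

    ∣filter∣-accept : ∀ {x} xs → Q x → suc (∣filter∣ xs) ≡ ∣filter∣ (x ∷ xs)
    ∣filter∣-accept xs qx = sym (cong length (filter-accept Q? qx))

    ∣filter∣-cons : ∀ x xs → ∣filter∣ xs ≤ ∣filter∣ (x ∷ xs)
    ∣filter∣-cons x xs with Q? x
    ... | yes _ = n≤1+n _
    ... | no  _ = ≤-refl

    ∣filter∣-pair-some : ∀ {x y} xs → SomeEnd Q (x , y) → suc (∣filter∣ xs) ≤ ∣filter∣ (x ∷ y ∷ xs)
    ∣filter∣-pair-some {y = y} xs (inj₁ qx) =
      ≤-trans (s≤s (∣filter∣-cons y xs)) (≤-reflexive (∣filter∣-accept (y ∷ xs) qx))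
    ∣filter∣-pair-some {x} xs (inj₂ qy) =
      ≤-trans (≤-reflexive (∣filter∣-accept xs qy)) (∣filter∣-cons x (_ ∷ xs))

    ∣filter∣-pair-both : ∀ {x y} xs → BothEnds Q (x , y) →
                         suc (suc (∣filter∣ xs)) ≡ ∣filter∣ (x ∷ y ∷ xs)
    ∣filter∣-pair-both xs (qx , qy) =
      trans (cong suc (∣filter∣-accept xs qy)) (∣filter∣-accept (_ ∷ xs) qx)

  length≤filter-endpoints : (M : List (Edge n)) → All (SomeEnd Q) M →
                            length M ≤ length (filter Q? (endpoints M))
  length≤filter-endpoints []      []       = z≤n
  length≤filter-endpoints (_ ∷ M) (q ∷ qs) =
    ≤-trans (s≤s (length≤filter-endpoints M qs)) (∣filter∣-pair-some (endpoints M) q)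

  length<filter-endpoints : (M : List (Edge n)) → All (SomeEnd Q) M → Any (BothEnds Q) M →
                            length M < length (filter Q? (endpoints M))
  length<filter-endpoints (_ ∷ M) (_ ∷ qs) (here q) =
    ≤-trans (s≤s (s≤s (length≤filter-endpoints M qs)))
            (≤-reflexive (∣filter∣-pair-both (endpoints M) q))
  length<filter-endpoints (_ ∷ M) (q ∷ qs) (there any) =
    ≤-trans (s≤s (length<filter-endpoints M qs any)) (∣filter∣-pair-some (endpoints M) q)

matched-partner : (M : List (Edge n)) {w : Fin n} → w ∈ₗ endpoints M →
                  ∃ λ s → s ∈ₗ endpoints M × ((w , s) ∈ₗ M ⊎ (s , w) ∈ₗ M)
matched-partner ((x , y) ∷ M) (here refl)         = y , there (here refl) , inj₁ (here refl)
matched-partner ((x , y) ∷ M) (there (here refl)) = x , here refl , inj₂ (here refl)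
matched-partner (_ ∷ M) (there (there w∈M)) =
  let s , s∈M , ws∈M = matched-partner M w∈M
  in s , there (there s∈M) , Sum.map there there ws∈M

Any-BothEnds : ∀ {M : List (Edge n)} {Q : Fin n → Set} {w s} →
               (w , s) ∈ₗ M ⊎ (s , w) ∈ₗ M → Q w → Q s → Any (BothEnds Q) M
Any-BothEnds (inj₁ ws∈M) qw qs = Any.map (λ { refl → qw , qs }) ws∈M
Any-BothEnds (inj₂ sw∈M) qw qs = Any.map (λ { refl → qs , qw }) sw∈M

IsStable-addEdge⁻ : ∀ (G : Graph n) {u v} (u≢v : u ≢ v) {T} →
                    IsStable (addEdge G u v u≢v) T → IsStable G T
IsStable-addEdge⁻ G u≢v T-stable x y x∈T y∈T x~y = T-stable x y x∈T y∈T (inj₁ x~y)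

module Tight {n} (G : Graph n) (M : List (Edge n)) (M-matching : IsMatching G M)
             {T : Subset n} (T-stable : IsStable G T) (tight : ∣ T ∣ + length M ≡ n) where

  private
    outside? : Decidable (_∉ T)
    outside? v = ¬? (v ∈? T)

    outer-ends : List (Fin n)
    outer-ends = filter outside? (endpoints M)

    outer-ends-unique : Unique outer-ends
    outer-ends-unique = filter⁺ outside? (proj₂ M-matching)

    outer-ends-outside : All (_∉ T) outer-ends
    outer-ends-outside = all-filter outside? (endpoints M)

    ∣∁T∣≡∣M∣ : ∣ ∁ T ∣ ≡ length M
    ∣∁T∣≡∣M∣ = trans (∣∁p∣≡n∸∣p∣ T) (trans (cong (_∸ ∣ T ∣) (sym tight)) (m+n∸m≡n ∣ T ∣ _))

    outside-bound : ∀ {xs} → Unique xs → All (_∉ T) xs → length xs ≤ length M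
    outside-bound {xs} !xs xs∉T =
      subst (length xs ≤_) ∣∁T∣≡∣M∣ (length≤∣p∣ (∁ T) !xs (All.map x∉p⇒x∈∁p xs∉T))

    edges-leave-T : All (SomeEnd (_∉ T)) M
    edges-leave-T = All.map leaves (proj₁ M-matching)
      where
      leaves : ∀ {e} → Adj G (proj₁ e) (proj₂ e) → SomeEnd (_∉ T) e
      leaves {x , y} x~y with x ∈? T | y ∈? T
      ... | yes x∈T | yes y∈T = contradiction x~y (T-stable x y x∈T y∈T)
      ... | yes _   | no y∉T  = inj₂ y∉T
      ... | no x∉T  | _       = inj₁ x∉T

  unmatched⇒∈ : ∀ {v} → v ∉ₗ endpoints M → v ∈ T
  unmatched⇒∈ {v} v∉M = decidable-stable (v ∈? T) λ v∉T →
    <⇒≱ (s≤s (length≤filter-endpoints outside? M edges-leave-T))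
        (outside-bound (v≢outer ∷ outer-ends-unique) (v∉T ∷ outer-ends-outside))
    where
    v≢outer : All (v ≢_) outer-ends
    v≢outer = ¬Any⇒All¬ outer-ends (λ v∈outer → v∉M (proj₁ (∈-filter⁻ outside? v∈outer)))

  ¬both-outside : ¬ Any (BothEnds (_∉ T)) M
  ¬both-outside any = <⇒≱ (length<filter-endpoints outside? M edges-leave-T any)
                         (outside-bound outer-ends-unique outer-ends-outside)

  partner∈ : ∀ {w s} → (w , s) ∈ₗ M ⊎ (s , w) ∈ₗ M → w ∉ T → s ∈ T
  partner∈ {s = s} ws∈M w∉T =
    decidable-stable (s ∈? T) (λ s∉T → ¬both-outside (Any-BothEnds ws∈M w∉T s∉T))

module _ {n} (G : Graph n) (α⁺-stable : IsAlphaPlusStable G) (no-isolated : NoIsolated G)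
         {a : ℕ} (α : IsAlpha G a) (M : List (Edge n)) (M-matching : IsMatching G M)
         (a+∣M∣≡n : a + length M ≡ n) where

  private
    MaxStable : Subset n → Set
    MaxStable T = IsStable G T × ∣ T ∣ ≡ a

    module TightMax {T} (T-max : MaxStable T) =
      Tight G M M-matching (proj₁ T-max) (trans (cong (_+ length M) (proj₂ T-max)) a+∣M∣≡n)

    S-max : MaxStable (proj₁ (proj₁ α))
    S-max = proj₂ (proj₁ α)

  ∣M∣≤a : length M ≤ a
  ∣M∣≤a = +-cancelʳ-≤ (length M) _ _
    (subst (length M + length M ≤_) (sym a+∣M∣≡n) (matching-size-bound M (proj₂ M-matching)))

  ∣M∣≮a : ¬ length M < a
  ∣M∣≮a ∣M∣<a = T-stable⁺ u s (u∈ T-max) (s∈ T-max) (inj₂ (inj₁ (refl , refl)))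
    where
    u,u∉M = length<n⇒∃∉ (endpoints M)
      (subst₂ _<_ (sym (length-endpoints M)) a+∣M∣≡n (+-monoˡ-< (length M) ∣M∣<a))
    u = proj₁ u,u∉M
    u∉M = proj₂ u,u∉M
    w = proj₁ (no-isolated u)
    u~w = proj₂ (no-isolated u)

    u∈ : ∀ {T} → MaxStable T → u ∈ T
    u∈ T-max = TightMax.unmatched⇒∈ T-max u∉M

    w∉ : ∀ {T} → MaxStable T → w ∉ T
    w∉ T-max w∈T = proj₁ T-max u w (u∈ T-max) w∈T u~w

    w∈M : w ∈ₗ endpoints M
    w∈M = decidable-stable (w ∈ₗ? endpoints M)
            (λ w∉M → w∉ S-max (TightMax.unmatched⇒∈ S-max w∉M))

    partner = matched-partner M w∈M
    s = proj₁ partner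

    s∈ : ∀ {T} → MaxStable T → s ∈ T
    s∈ T-max = TightMax.partner∈ T-max (proj₂ (proj₂ partner)) (w∉ T-max)

    u≢s : u ≢ s
    u≢s u≡s = u∉M (subst (_∈ₗ endpoints M) (sym u≡s) (proj₁ (proj₂ partner)))

    α⁺ = α⁺-stable a α u s u≢s (proj₁ S-max u s (u∈ S-max) (s∈ S-max))
    T-stable⁺ = proj₁ (proj₂ (proj₁ α⁺))
    T-max : MaxStable (proj₁ (proj₁ α⁺))
    T-max = IsStable-addEdge⁻ G u≢s T-stable⁺ , proj₂ (proj₂ (proj₁ α⁺))

  twice-α≡n : 2 * a ≡ n
  twice-α≡n = begin
    a + (a + 0)    ≡⟨ cong (a +_) (+-identityʳ a) ⟩
    a + a          ≡⟨ cong (a +_) (≤-antisym (≮⇒≥ ∣M∣≮a) ∣M∣≤a) ⟩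
    a + length M   ≡⟨ a+∣M∣≡n ⟩
    n              ∎
    where open ≡-Reasoning

IsMaximum : (ℕ → Set) → ℕ → Set
IsMaximum P m = P m × (∀ j → P j → j ≤ m)

¬¬-bounded-maximum : ∀ {P : ℕ → Set} {i} k → P i → (∀ j → P j → j ≤ k) →
                     ¬ ¬ ∃ (IsMaximum P)
¬¬-bounded-maximum {i = i} zero Pi ≤0 no-max =
  no-max (i , Pi , λ j Pj → ≤-trans (≤0 j Pj) z≤n)
¬¬-bounded-maximum {P} (suc k) Pi ≤1+k no-max = ¬¬-excluded-middle (λ where
    (yes P[1+k]) → no-max (suc k , P[1+k] , ≤1+k)
    (no ¬P[1+k]) → ¬¬-bounded-maximum k Pi (≤k ¬P[1+k]) no-max)
  where
  ≤k : ¬ P (suc k) → ∀ j → P j → j ≤ k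
  ≤k ¬P[1+k] j Pj = m<1+n⇒m≤n (≤∧≢⇒< (≤1+k j Pj) (λ { refl → ¬P[1+k] Pj }))

¬¬-∃IsMu : (G : Graph n) → ¬ ¬ ∃ (IsMu G)
¬¬-∃IsMu {n} G = ¬¬-map toIsMu (¬¬-bounded-maximum n empty-matching size≤n)
  where
  MatchingSize : ℕ → Set
  MatchingSize k = ∃ λ M → IsMatching G M × length M ≡ k

  empty-matching : MatchingSize 0
  empty-matching = [] , ([] , []) , refl

  size≤n : ∀ k → MatchingSize k → k ≤ n
  size≤n _ (M , (_ , !ends) , refl) = ≤-trans (m≤m+n _ _) (matching-size-bound M !ends)

  toIsMu : ∃ (IsMaximum MatchingSize) → ∃ (IsMu G)
  toIsMu (m , M , max) = m , M , λ M′ M′-matching → max (length M′) (M′ , M′-matching , refl)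

proposition5 : ∀ (n : ℕ) (G : Graph n) → IsKE G → IsAlphaPlusStable G → NoIsolated G →
    ∀ a → IsAlpha G a → 2 * a ≡ n
proposition5 n G ke α⁺-stable no-isolated a α =
  decidable-stable (2 * a ≟ n) (¬¬-map from-maximum-matching (¬¬-∃IsMu G))
  where
  from-maximum-matching : ∃ (IsMu G) → 2 * a ≡ n
  from-maximum-matching (m , μ@((M , M-matching , refl) , _)) =
    twice-α≡n G α⁺-stable no-isolated α M M-matching (ke a m α μ)
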